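{- Let $G$ be an $n$-vertex simple graph with $n\ge 7$. If $G$ has no matching of size $3$ and $\delta(G)\ge 2$, then $G$ is isomorphic to the book graph $B_{n-2}$ or to $B_{n-2}^-$.
   Context: For a positive integer $t$, the book graph $B_t$ is the graph obtained from $t$ triangles sharing one common edge (so it has $t+2$ vertices). $B_t^-$ is obtained from $B_t$ by deleting the common edge. $\delta(G)$ is the minimum degree. -}

module Defs where

open import Data.Nat using (ℕ; suc; _+_; _≤_)
open import Data.Fin using (Fin; zero; suc)
open import Data.Bool using (Bool; true; false; _∨_; _∧_; not)
open import Data.List using (List; length; filter)
open import Data.List.Base using (allFin)
open import Data.Product using (Σ; _×_; _,_)
open import Relation.Binary.PropositionalEquality using (_≡_; _≢_)
open import Function.Bundles using (_↔_; Inverse)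
open import Relation.Nullary using (¬_)
open import Data.Bool.Properties using (T?)

record Graph (n : ℕ) : Set where
  field
    adj   : Fin n → Fin n → Bool
    sym   : ∀ u v → adj u v ≡ adj v u
    loopless : ∀ v → adj v v ≡ false
open Graph public

Edge : ∀ {n} → Graph n → Fin n → Fin n → Set
Edge G u v = adj G u v ≡ true

degree : ∀ {n} → Graph n → Fin n → ℕ
degree {n} G v = length (filter (λ u → T? (adj G v u)) (allFin n))

MinDegree≥ : ∀ {n} → Graph n → ℕ → Set
MinDegree≥ G k = ∀ v → k ≤ degree G v

HasMatching3 : ∀ {n} → Graph n → Set
HasMatching3 {n} G =
  Σ (Fin n) λ a₁ → Σ (Fin n) λ b₁ → Σ (Fin n) λ a₂ →
  Σ (Fin n) λ b₂ → Σ (Fin n) λ a₃ → Σ (Fin n) λ b₃ →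
    Edge G a₁ b₁ × Edge G a₂ b₂ × Edge G a₃ b₃ ×
    a₁ ≢ b₁ × a₁ ≢ a₂ × a₁ ≢ b₂ × a₁ ≢ a₃ × a₁ ≢ b₃ ×
    b₁ ≢ a₂ × b₁ ≢ b₂ × b₁ ≢ a₃ × b₁ ≢ b₃ ×
    a₂ ≢ b₂ × a₂ ≢ a₃ × a₂ ≢ b₃ ×
    b₂ ≢ a₃ × b₂ ≢ b₃ ×
    a₃ ≢ b₃

_≅_ : ∀ {n} → Graph n → Graph n → Set
_≅_ {n} G H = Σ (Fin n ↔ Fin n) λ f →
  ∀ u v → adj H (Inverse.to f u) (Inverse.to f v) ≡ adj G u v

isSpine : ∀ {m} → Fin m → Bool
isSpine zero = true
isSpine (suc zero) = true
isSpine (suc (suc _)) = false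

-- adjacency for books on Fin (t + 2), with vertices 0,1 the common edge's
-- endpoints and the other t vertices the pages.
-- bookAdjWith b: page–spine pairs adjacent; spine pair adjacent iff b.
bookAdjWith : ∀ {m} → Bool → Fin m → Fin m → Bool
bookAdjWith b zero zero = false
bookAdjWith b zero (suc zero) = b
bookAdjWith b (suc zero) zero = b
bookAdjWith b (suc zero) (suc zero) = false
bookAdjWith b zero (suc (suc _)) = true
bookAdjWith b (suc zero) (suc (suc _)) = true
bookAdjWith b (suc (suc _)) v = isSpine v

private
  bookSym : ∀ {m} b (u v : Fin m) → bookAdjWith b u v ≡ bookAdjWith b v u
  bookSym b zero zero = Relation.Binary.PropositionalEquality.refl
  bookSym b zero (suc zero) = Relation.Binary.PropositionalEquality.refl
  bookSym b zero (suc (suc v)) = Relation.Binary.PropositionalEquality.refl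
  bookSym b (suc zero) zero = Relation.Binary.PropositionalEquality.refl
  bookSym b (suc zero) (suc zero) = Relation.Binary.PropositionalEquality.refl
  bookSym b (suc zero) (suc (suc v)) = Relation.Binary.PropositionalEquality.refl
  bookSym b (suc (suc u)) zero = Relation.Binary.PropositionalEquality.refl
  bookSym b (suc (suc u)) (suc zero) = Relation.Binary.PropositionalEquality.refl
  bookSym b (suc (suc u)) (suc (suc v)) = Relation.Binary.PropositionalEquality.refl

  bookLoop : ∀ {m} b (v : Fin m) → bookAdjWith b v v ≡ false
  bookLoop b zero = Relation.Binary.PropositionalEquality.refl
  bookLoop b (suc zero) = Relation.Binary.PropositionalEquality.refl
  bookLoop b (suc (suc v)) = Relation.Binary.PropositionalEquality.refl

-- B_t : t triangles sharing the common edge {0,1}; t + 2 vertices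
Book : (t : ℕ) → Graph (t + 2)
Book t = record { adj = bookAdjWith true ; sym = bookSym true ; loopless = bookLoop true }

Book⁻ : (t : ℕ) → Graph (t + 2)
Book⁻ t = record { adj = bookAdjWith false ; sym = bookSym false ; loopless = bookLoop false }

-- Take two disjoint edges ab and cd. As there is no matching of size 3, every
-- other vertex has all its neighbours among a, b, c, d, and two distinct such
-- vertices never see opposite ends of the same edge. Given three of them, none
-- sees both a and b (the other two would then see only c and d), so one of them
-- sees, say, a and c; it follows that {a, c} meets every edge. Minimum degree 2
-- then makes every other vertex adjacent to both a and c: this is B_{n-2} with
-- spine ac, or B_{n-2}⁻ when a and c are not adjacent.
module Submission where

open import Defs hiding (sym)
open import Data.Bool using (Bool; true; false)
open import Data.Bool.Properties using (T?; T-≡)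
open import Data.Empty using (⊥; ⊥-elim)
open import Data.Fin using (Fin; zero; suc; fromℕ<)
open import Data.Fin.Properties using (_≟_; ¬∀⟶∃¬; pigeonhole; <⇒≢)
open import Data.Fin.Permutation using (Permutation′; _∘ₚ_; transpose; _⟨$⟩ʳ_)
import Data.Fin.Permutation.Components as PC
open import Data.List using (List; []; _∷_; length; filter; lookup)
open import Data.List.Base using (allFin)
open import Data.List.Membership.Propositional using (_∈_; _∉_)
open import Data.List.Membership.Propositional.Properties using (∈-filter⁻)
open import Data.List.Relation.Unary.Any using (here; there; index)
open import Data.List.Relation.Unary.Any.Properties using (lookup-index)
open import Data.List.Relation.Unary.All using (_∷_)
open import Data.List.Relation.Unary.AllPairs using (_∷_)
open import Data.List.Relation.Unary.Unique.Propositional using (Unique)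
open import Data.List.Relation.Unary.Unique.Propositional.Properties using (allFin⁺; filter⁺)
open import Data.Nat using (ℕ; suc; _+_; _<_; _≤_; s≤s; z≤n)
open import Data.Nat.Properties using (≤-trans; m≤m+n; +-comm)
open import Data.Product using (Σ; ∃; ∃₂; _×_; _,_; proj₁; proj₂; uncurry)
open import Data.Sum using (_⊎_; inj₁; inj₂)
import Data.Sum as Sum
open import Function.Base using (_∘_)
open import Function.Bundles using (_↔_; Inverse; Injection; Equivalence)
open import Function.Properties.Inverse using (↔⇒↣)
open import Relation.Nullary using (¬_; yes; no)
open import Relation.Binary.PropositionalEquality
  using (_≡_; _≢_; refl; sym; trans; cong; subst; ≢-sym; module ≡-Reasoning)

fresh : ∀ {n} (xs : List (Fin n)) → length xs < n → ∃ λ v → v ∉ xs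
fresh {n} xs |xs|<n = ¬∀⟶∃¬ n (_∈ xs) (_∈? xs) λ all∈ →
  let (i , j , i<j , same-index) = pigeonhole |xs|<n (λ v → index (all∈ v))
  in <⇒≢ i<j (begin
       i                             ≡⟨ lookup-index (all∈ i) ⟩
       lookup xs (index (all∈ i))    ≡⟨ cong (lookup xs) same-index ⟩
       lookup xs (index (all∈ j))    ≡⟨ sym (lookup-index (all∈ j)) ⟩
       j                             ∎)
  where
  open ≡-Reasoning
  open import Data.List.Membership.DecPropositional (_≟_ {n}) using (_∈?_)

two-distinct-members : ∀ {A : Set} {xs : List A} → Unique xs → 2 ≤ length xs →
                       ∃₂ λ u w → u ≢ w × u ∈ xs × w ∈ xs
two-distinct-members {xs = u ∷ w ∷ _} ((u≢w ∷ _) ∷ _) _ = u , w , u≢w , here refl , there (here refl)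
two-distinct-members {xs = _ ∷ []} _ (s≤s ())

∉⇒≢ : ∀ {A : Set} {v x : A} {xs} → v ∉ xs → x ∈ xs → v ≢ x
∉⇒≢ v∉ x∈ refl = v∉ x∈

both-of-pair : ∀ {A : Set} {P : A → Set} {a b u w : A} → u ≢ w →
               u ≡ a ⊎ u ≡ b → w ≡ a ⊎ w ≡ b → P u → P w → P a × P b
both-of-pair u≢w (inj₁ refl) (inj₁ refl) _  _  = ⊥-elim (u≢w refl)
both-of-pair u≢w (inj₁ refl) (inj₂ refl) pu pw = pu , pw
both-of-pair u≢w (inj₂ refl) (inj₁ refl) pu pw = pw , pu
both-of-pair u≢w (inj₂ refl) (inj₂ refl) _  _  = ⊥-elim (u≢w refl)

transpose-right : ∀ {n} (i j : Fin n) → PC.transpose i j j ≡ i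
transpose-right i j with j ≟ i
... | yes j≡i = j≡i
... | no _ with j ≟ j
...   | yes _   = refl
...   | no j≢j  = ⊥-elim (j≢j refl)

transpose-other : ∀ {n} (i j k : Fin n) → k ≢ i → k ≢ j → PC.transpose i j k ≡ k
transpose-other i j k k≢i k≢j with k ≟ i
... | yes k≡i = ⊥-elim (k≢i k≡i)
... | no _ with k ≟ j
...   | yes k≡j = ⊥-elim (k≢j k≡j)
...   | no _    = refl

permutation-injective : ∀ {n} (π : Permutation′ n) {u v} → π ⟨$⟩ʳ u ≡ π ⟨$⟩ʳ v → u ≡ v
permutation-injective π = Injection.injective (↔⇒↣ π)

move-to-front : ∀ {m} {x y : Fin (suc (suc m))} → x ≢ y →
                 Σ (Permutation′ (suc (suc m))) λ π → π ⟨$⟩ʳ x ≡ zero × π ⟨$⟩ʳ y ≡ suc zero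
move-to-front {x = x} {y} x≢y = σ ∘ₚ τ , (begin
    PC.transpose (suc zero) y′ (PC.transpose zero x x) ≡⟨ cong (PC.transpose (suc zero) y′) (transpose-right zero x) ⟩
    PC.transpose (suc zero) y′ zero                    ≡⟨ transpose-other (suc zero) y′ zero (λ ()) (≢-sym y′≢0) ⟩
    zero                                               ∎)
  , transpose-right (suc zero) y′
  where
  open ≡-Reasoning
  σ = transpose zero x
  y′ = σ ⟨$⟩ʳ y
  τ = transpose (suc zero) y′
  y′≢0 : y′ ≢ zero
  y′≢0 y′≡0 = x≢y (permutation-injective σ (trans (transpose-right zero x) (sym y′≡0)))

module _ {n : ℕ} (G : Graph n) where

  edge-sym : ∀ {u v} → Edge G u v → Edge G v u
  edge-sym {u} {v} e = trans (Graph.sym G v u) e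

  edge-irrefl : ∀ {u v} → Edge G u v → u ≢ v
  edge-irrefl {u} e refl with trans (sym (loopless G u)) e
  ... | ()

  HasTwoNeighbours : Fin n → Set
  HasTwoNeighbours v = ∃₂ λ u w → u ≢ w × Edge G v u × Edge G v w

  two-neighbours : MinDegree≥ G 2 → ∀ v → HasTwoNeighbours v
  two-neighbours δ≥2 v
    with u , w , u≢w , u∈ , w∈ ← two-distinct-members (filter⁺ (λ u → T? (adj G v u)) (allFin⁺ n)) (δ≥2 v)
    = u , w , u≢w , adjacent u∈ , adjacent w∈
    where
    adjacent : ∀ {u} → u ∈ filter (λ u → T? (adj G v u)) (allFin n) → Edge G v u
    adjacent u∈ = Equivalence.to T-≡ (proj₂ (∈-filter⁻ (λ u → T? (adj G v u)) {xs = allFin n} u∈))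

  neighbour-other-than : ∀ {v} → HasTwoNeighbours v → ∀ w → ∃ λ u → Edge G v u × u ≢ w
  neighbour-other-than (u₁ , u₂ , u₁≢u₂ , vu₁ , vu₂) w with u₁ ≟ w
  ... | yes refl = u₂ , vu₂ , ≢-sym u₁≢u₂
  ... | no u₁≢w  = u₁ , vu₁ , u₁≢w

  neighbours-in-pair : ∀ {v x y} → HasTwoNeighbours v → (∀ u → Edge G v u → u ≡ x ⊎ u ≡ y) →
                       Edge G v x × Edge G v y
  neighbours-in-pair (u₁ , u₂ , u₁≢u₂ , vu₁ , vu₂) only =
    both-of-pair {P = Edge G _} u₁≢u₂ (only u₁ vu₁) (only u₂ vu₂) vu₁ vu₂

  VertexCover : Fin n → Fin n → Set
  VertexCover x y = ∀ v → v ≢ x → v ≢ y → ∀ u → Edge G v u → u ≡ x ⊎ u ≡ y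

  cover-attached : (∀ v → HasTwoNeighbours v) → ∀ {x y} → VertexCover x y →
                   ∀ v → v ≢ x → v ≢ y → Edge G v x × Edge G v y
  cover-attached neighbours cover v v≢x v≢y = neighbours-in-pair (neighbours v) (cover v v≢x v≢y)

  cover-nonadjacent : ∀ {x y u v} → VertexCover x y → u ≢ x → u ≢ y → v ≢ x → v ≢ y → adj G u v ≡ false
  cover-nonadjacent {u = u} {v} cover u≢x u≢y v≢x v≢y with adj G u v in uv
  ... | false = refl
  ... | true with cover u u≢x u≢y v uv
  ...   | inj₁ v≡x = ⊥-elim (v≢x v≡x)
  ...   | inj₂ v≡y = ⊥-elim (v≢y v≡y)

module MatchingFree {n : ℕ} (G : Graph n) (no-3-matching : ¬ HasMatching3 G)
                    (neighbours : ∀ v → HasTwoNeighbours G v) where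

  E : Fin n → Fin n → Set
  E = Edge G

  three-disjoint-edges-absurd : ∀ {a₁ b₁ a₂ b₂ a₃ b₃} → E a₁ b₁ → E a₂ b₂ → E a₃ b₃ →
    a₁ ≢ a₂ → a₁ ≢ b₂ → a₁ ≢ a₃ → a₁ ≢ b₃ → b₁ ≢ a₂ → b₁ ≢ b₂ → b₁ ≢ a₃ → b₁ ≢ b₃ →
    a₂ ≢ a₃ → a₂ ≢ b₃ → b₂ ≢ a₃ → b₂ ≢ b₃ → ⊥
  three-disjoint-edges-absurd {a₁} {b₁} {a₂} {b₂} {a₃} {b₃} e₁ e₂ e₃ p₁ p₂ p₃ p₄ p₅ p₆ p₇ p₈ p₉ p₁₀ p₁₁ p₁₂ =
    no-3-matching (a₁ , b₁ , a₂ , b₂ , a₃ , b₃ , e₁ , e₂ , e₃ , edge-irrefl G e₁ , p₁ , p₂ , p₃ , p₄ ,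
                   p₅ , p₆ , p₇ , p₈ , edge-irrefl G e₂ , p₉ , p₁₀ , p₁₁ , p₁₂ , edge-irrefl G e₃)

  record TwoMatching : Set where
    field
      a b c d : Fin n
      ab : E a b
      cd : E c d
      a≢c : a ≢ c
      a≢d : a ≢ d
      b≢c : b ≢ c
      b≢d : b ≢ d

  flip₁ flip₂ swap-edges : TwoMatching → TwoMatching
  flip₁ C = record { a = b ; b = a ; ab = edge-sym G ab ; a≢c = b≢c ; a≢d = b≢d ; b≢c = a≢c ; b≢d = a≢d ; cd = cd }
    where open TwoMatching C
  flip₂ C = record { c = d ; d = c ; cd = edge-sym G cd ; a≢c = a≢d ; a≢d = a≢c ; b≢c = b≢d ; b≢d = b≢c ; ab = ab }
    where open TwoMatching C
  swap-edges C = record { a = c ; b = d ; c = a ; d = b ; ab = cd ; cd = ab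
                        ; a≢c = ≢-sym a≢c ; a≢d = ≢-sym b≢c ; b≢c = ≢-sym a≢d ; b≢d = ≢-sym b≢d }
    where open TwoMatching C

  Outside : TwoMatching → Fin n → Set
  Outside C v = v ≢ a × v ≢ b × v ≢ c × v ≢ d
    where open TwoMatching C

  Endpoint : TwoMatching → Fin n → Set
  Endpoint C v = (v ≡ a ⊎ v ≡ b) ⊎ (v ≡ c ⊎ v ≡ d)
    where open TwoMatching C

  locate : ∀ C v → Endpoint C v ⊎ Outside C v
  locate C v with v ≟ a | v ≟ b | v ≟ c | v ≟ d
    where open TwoMatching C
  ... | yes v≡a | _       | _       | _       = inj₁ (inj₁ (inj₁ v≡a))
  ... | no _    | yes v≡b | _       | _       = inj₁ (inj₁ (inj₂ v≡b))
  ... | no _    | no _    | yes v≡c | _       = inj₁ (inj₂ (inj₁ v≡c))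
  ... | no _    | no _    | no _    | yes v≡d = inj₁ (inj₂ (inj₂ v≡d))
  ... | no v≢a  | no v≢b  | no v≢c  | no v≢d  = inj₂ (v≢a , v≢b , v≢c , v≢d)

  module _ (C : TwoMatching) where
    open TwoMatching C

    outside-flip₁ : ∀ {v} → Outside C v → Outside (flip₁ C) v
    outside-flip₁ (v≢a , v≢b , v≢c , v≢d) = v≢b , v≢a , v≢c , v≢d

    outside-flip₂ : ∀ {v} → Outside C v → Outside (flip₂ C) v
    outside-flip₂ (v≢a , v≢b , v≢c , v≢d) = v≢a , v≢b , v≢d , v≢c

    outside-swap : ∀ {v} → Outside C v → Outside (swap-edges C) v
    outside-swap (v≢a , v≢b , v≢c , v≢d) = v≢c , v≢d , v≢a , v≢b

    outside-neighbour : ∀ {r s} → Outside C r → E r s → Endpoint C s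
    outside-neighbour {r} {s} (r≢a , r≢b , r≢c , r≢d) rs with locate C s
    ... | inj₁ s-end = s-end
    ... | inj₂ (s≢a , s≢b , s≢c , s≢d) =
      ⊥-elim (three-disjoint-edges-absurd rs ab cd r≢a r≢b r≢c r≢d s≢a s≢b s≢c s≢d a≢c a≢d b≢c b≢d)

    opposite-ends-absurd : ∀ {r r′} → Outside C r → Outside C r′ → r ≢ r′ → E r a → E r′ b → ⊥
    opposite-ends-absurd (r≢a , r≢b , r≢c , r≢d) (r′≢a , r′≢b , r′≢c , r′≢d) r≢r′ ra r′b =
      three-disjoint-edges-absurd ra r′b cd r≢r′ r≢b r≢c r≢d (≢-sym r′≢a) (edge-irrefl G ab)
        a≢c a≢d r′≢c r′≢d b≢c b≢d

  module _ (C : TwoMatching) where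
    open TwoMatching C

    both-ends-absurd : ∀ {p q r} → Outside C p → Outside C q → Outside C r →
                       p ≢ q → p ≢ r → q ≢ r → E p a → E p b → ⊥
    both-ends-absurd {p} p-out@(p≢a , _ , p≢c , p≢d) q-out@(q≢a , _ , _ , q≢d) r-out@(r≢a , _ , r≢c , _)
                     p≢q p≢r q≢r pa pb =
      three-disjoint-edges-absurd pa qc rd p≢q p≢c p≢r p≢d (≢-sym q≢a) a≢c (≢-sym r≢a) a≢d
        q≢r q≢d (≢-sym r≢c) (edge-irrefl G cd)
      where
      sees-only-cd : ∀ {s} → Outside C s → p ≢ s → E s c × E s d
      sees-only-cd {s} s-out p≢s = neighbours-in-pair G (neighbours s) only
        where
        only : ∀ u → E s u → u ≡ c ⊎ u ≡ d
        only u su with outside-neighbour C s-out su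
        ... | inj₁ (inj₁ refl) = ⊥-elim (opposite-ends-absurd (flip₁ C) (outside-flip₁ C p-out) (outside-flip₁ C s-out) p≢s pb su)
        ... | inj₁ (inj₂ refl) = ⊥-elim (opposite-ends-absurd C p-out s-out p≢s pa su)
        ... | inj₂ c-or-d      = c-or-d
      qc = proj₁ (sees-only-cd q-out p≢q)
      rd = proj₂ (sees-only-cd r-out p≢r)

    sees-only-a-c : ∀ {p r} → Outside C p → E p a → E p c → Outside C r → p ≢ r →
                    ∀ u → E r u → u ≡ a ⊎ u ≡ c
    sees-only-a-c p-out pa pc r-out p≢r u ru with outside-neighbour C r-out ru
    ... | inj₁ (inj₁ refl) = inj₁ refl
    ... | inj₁ (inj₂ refl) = ⊥-elim (opposite-ends-absurd C p-out r-out p≢r pa ru)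
    ... | inj₂ (inj₁ refl) = inj₂ refl
    ... | inj₂ (inj₂ refl) =
      ⊥-elim (opposite-ends-absurd (swap-edges C) (outside-swap C p-out) (outside-swap C r-out) p≢r pc ru)

    -- For r = p, run the same argument with q as the pivot.
    outside-sees-only-a-c : ∀ {p q} → Outside C p → Outside C q → p ≢ q → E p a → E p c →
                            ∀ {r} → Outside C r → ∀ u → E r u → u ≡ a ⊎ u ≡ c
    outside-sees-only-a-c {p} {q} p-out q-out p≢q pa pc {r} r-out with p ≟ r
    ... | no p≢r = sees-only-a-c p-out pa pc r-out p≢r
    ... | yes refl = sees-only-a-c q-out qa qc r-out (≢-sym p≢q)
      where
      qa×qc = neighbours-in-pair G (neighbours q) (sees-only-a-c p-out pa pc q-out p≢q)
      qa = proj₁ qa×qc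
      qc = proj₂ qa×qc

    endpoint-sees-only-a-c : ∀ {p q} → Outside C p → Outside C q → p ≢ q → E p a → E q c →
                             (∀ {r} → Outside C r → ∀ u → E r u → u ≡ a ⊎ u ≡ c) →
                             ∀ u → E b u → u ≡ a ⊎ u ≡ c
    endpoint-sees-only-a-c (p≢a , p≢b , p≢c , p≢d) (q≢a , q≢b , q≢c , q≢d) p≢q pa qc only u bu
      with locate C u
    ... | inj₁ (inj₁ (inj₁ refl)) = inj₁ refl
    ... | inj₁ (inj₁ (inj₂ refl)) = ⊥-elim (edge-irrefl G bu refl)
    ... | inj₁ (inj₂ (inj₁ refl)) = inj₂ refl
    ... | inj₁ (inj₂ (inj₂ refl)) =
      ⊥-elim (three-disjoint-edges-absurd bu pa qc (≢-sym p≢b) (≢-sym (edge-irrefl G ab)) (≢-sym q≢b) b≢c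
                (≢-sym p≢d) (≢-sym a≢d) (≢-sym q≢d) (≢-sym (edge-irrefl G cd)) p≢q p≢c (≢-sym q≢a) a≢c)
    ... | inj₂ u-out with only u-out b (edge-sym G bu)
    ...   | inj₁ b≡a = ⊥-elim (edge-irrefl G ab (sym b≡a))
    ...   | inj₂ b≡c = ⊥-elim (b≢c b≡c)

  module _ (C : TwoMatching) where
    open TwoMatching C

    cross-cover : ∀ {p q} → Outside C p → Outside C q → p ≢ q → E p a → E p c → VertexCover G a c
    cross-cover {p} {q} p-out q-out p≢q pa pc v v≢a v≢c = sees-only-a-c-at v≢a v≢c (locate C v)
      where
      only : ∀ {r} → Outside C r → ∀ u → E r u → u ≡ a ⊎ u ≡ c
      only = outside-sees-only-a-c C p-out q-out p≢q pa pc
      qa×qc = neighbours-in-pair G (neighbours q) (only q-out)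
      sees-only-a-c-at : ∀ {v} → v ≢ a → v ≢ c → Endpoint C v ⊎ Outside C v → ∀ u → E v u → u ≡ a ⊎ u ≡ c
      sees-only-a-c-at v≢a _ (inj₁ (inj₁ (inj₁ v≡a))) = ⊥-elim (v≢a v≡a)
      sees-only-a-c-at _ _ (inj₁ (inj₁ (inj₂ refl))) = endpoint-sees-only-a-c C p-out q-out p≢q pa (proj₂ qa×qc) only
      sees-only-a-c-at _ v≢c (inj₁ (inj₂ (inj₁ v≡c))) = ⊥-elim (v≢c v≡c)
      sees-only-a-c-at _ _ (inj₁ (inj₂ (inj₂ refl))) u du =
        Sum.swap (endpoint-sees-only-a-c (swap-edges C) (outside-swap C p-out) (outside-swap C q-out) p≢q
                    pc (proj₁ qa×qc) (λ r-out u ru → Sum.swap (only (outside-swap (swap-edges C) r-out) u ru)) u du)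
      sees-only-a-c-at _ _ (inj₂ v-out) = only v-out

  module _ (C : TwoMatching) where
    open TwoMatching C

    cross-cover′ : ∀ {p q u w} → Outside C p → Outside C q → p ≢ q →
                   u ≡ a ⊎ u ≡ b → w ≡ c ⊎ w ≡ d → E p u → E p w → u ≢ w × VertexCover G u w
    cross-cover′ p-out q-out p≢q (inj₁ refl) (inj₁ refl) pu pw =
      a≢c , cross-cover C p-out q-out p≢q pu pw
    cross-cover′ p-out q-out p≢q (inj₁ refl) (inj₂ refl) pu pw =
      a≢d , cross-cover (flip₂ C) (outside-flip₂ C p-out) (outside-flip₂ C q-out) p≢q pu pw
    cross-cover′ p-out q-out p≢q (inj₂ refl) (inj₁ refl) pu pw =
      b≢c , cross-cover (flip₁ C) (outside-flip₁ C p-out) (outside-flip₁ C q-out) p≢q pu pw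
    cross-cover′ p-out q-out p≢q (inj₂ refl) (inj₂ refl) pu pw =
      b≢d , cross-cover (flip₁ (flip₂ C)) (outside-flip₁ (flip₂ C) (outside-flip₂ C p-out))
                        (outside-flip₁ (flip₂ C) (outside-flip₂ C q-out)) p≢q pu pw

  record ThreeOutside (C : TwoMatching) : Set where
    constructor three-outside
    field
      {p q r} : Fin n
      p-out : Outside C p
      q-out : Outside C q
      r-out : Outside C r
      p≢q : p ≢ q
      p≢r : p ≢ r
      q≢r : q ≢ r

  cover-from-outsiders : ∀ C → ThreeOutside C → ∃₂ λ x y → x ≢ y × VertexCover G x y
  cover-from-outsiders C (three-outside {p} p-out q-out r-out p≢q p≢r q≢r)
    with u , w , u≢w , pu , pw ← neighbours p
    with outside-neighbour C p-out pu | outside-neighbour C p-out pw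
  ... | inj₁ u∈ab | inj₁ w∈ab =
    ⊥-elim (uncurry (both-ends-absurd C p-out q-out r-out p≢q p≢r q≢r)
                    (both-of-pair {P = E p} u≢w u∈ab w∈ab pu pw))
  ... | inj₂ u∈cd | inj₂ w∈cd =
    ⊥-elim (uncurry (both-ends-absurd (swap-edges C) (outside-swap C p-out) (outside-swap C q-out)
                                      (outside-swap C r-out) p≢q p≢r q≢r)
                    (both-of-pair {P = E p} u≢w u∈cd w∈cd pu pw))
  ... | inj₁ u∈ab | inj₂ w∈cd = u , w , cross-cover′ C p-out q-out p≢q u∈ab w∈cd pu pw
  ... | inj₂ u∈cd | inj₁ w∈ab = w , u , cross-cover′ C p-out q-out p≢q w∈ab u∈cd pw pu

  two-matching : 3 < n → TwoMatching
  two-matching 3<n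
    with v ← fromℕ< (≤-trans (s≤s z≤n) 3<n)
    with p , q , p≢q , vp , vq ← neighbours v
    with r , r∉ ← fresh (v ∷ p ∷ q ∷ []) 3<n
    with s , rs , s≢v ← neighbour-other-than G (neighbours r) v
    with s ≟ p
  ... | no s≢p = record
    { a = v ; b = p ; c = r ; d = s ; ab = vp ; cd = rs
    ; a≢c = ≢-sym (∉⇒≢ r∉ (here refl)) ; a≢d = ≢-sym s≢v
    ; b≢c = ≢-sym (∉⇒≢ r∉ (there (here refl))) ; b≢d = ≢-sym s≢p }
  ... | yes refl = record
    { a = v ; b = q ; c = r ; d = s ; ab = vq ; cd = rs
    ; a≢c = ≢-sym (∉⇒≢ r∉ (here refl)) ; a≢d = edge-irrefl G vp
    ; b≢c = ≢-sym (∉⇒≢ r∉ (there (there (here refl)))) ; b≢d = ≢-sym p≢q }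

  endpoints : TwoMatching → List (Fin n)
  endpoints C = a ∷ b ∷ c ∷ d ∷ []
    where open TwoMatching C

  outside-of-∉ : ∀ C {v} → v ∉ endpoints C → Outside C v
  outside-of-∉ C v∉ = ∉⇒≢ v∉ (here refl) , ∉⇒≢ v∉ (there (here refl)) ,
                      ∉⇒≢ v∉ (there (there (here refl))) , ∉⇒≢ v∉ (there (there (there (here refl))))

  three-outside-of : 6 < n → ∀ C → ThreeOutside C
  three-outside-of 6<n C
    with p , p∉ ← fresh (endpoints C) (≤-trans (m≤m+n 5 2) 6<n)
    with q , q∉ ← fresh (p ∷ endpoints C) (≤-trans (m≤m+n 6 1) 6<n)
    with r , r∉ ← fresh (q ∷ p ∷ endpoints C) 6<n
    = three-outside (outside-of-∉ C p∉) (outside-of-∉ C (q∉ ∘ there)) (outside-of-∉ C (r∉ ∘ there ∘ there))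
        (≢-sym (∉⇒≢ q∉ (here refl))) (≢-sym (∉⇒≢ r∉ (there (here refl)))) (≢-sym (∉⇒≢ r∉ (here refl)))

  two-vertex-cover : 6 < n → ∃₂ λ x y → x ≢ y × VertexCover G x y
  two-vertex-cover 6<n = cover-from-outsiders C (three-outside-of 6<n C)
    where C = two-matching (≤-trans (m≤m+n 4 3) 6<n)

data Role {n} (x y : Fin n) : Fin n → Set where
  spine-x : Role x y x
  spine-y : Role x y y
  page    : ∀ {v} → v ≢ x → v ≢ y → Role x y v

role : ∀ {n} (x y v : Fin n) → Role x y v
role x y v with v ≟ x | v ≟ y
... | yes refl | _        = spine-x
... | no _     | yes refl = spine-y
... | no v≢x   | no v≢y   = page v≢x v≢y

-- G ≅ Book t and G ≅ Book⁻ t unfold to this with b = true and b = false.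
_≅Book[_] : ∀ {n} → Graph n → Bool → Set
_≅Book[_] {n} G b = Σ (Fin n ↔ Fin n) λ f → ∀ u v → bookAdjWith b (Inverse.to f u) (Inverse.to f v) ≡ adj G u v

book-from-cover : ∀ {m} (G : Graph (suc (suc m))) {x y} → x ≢ y → VertexCover G x y →
                  (∀ v → v ≢ x → v ≢ y → Edge G v x × Edge G v y) → G ≅Book[ adj G x y ]
book-from-cover G {x} {y} x≢y cover attached
  with π , πx , πy ← move-to-front x≢y
  = π , λ u v → preserves (role x y u) (role x y v)
  where
  page-image : ∀ {v} → v ≢ x → v ≢ y → ∃ λ k → π ⟨$⟩ʳ v ≡ suc (suc k)
  page-image {v} v≢x v≢y with π ⟨$⟩ʳ v in πv
  ... | zero        = ⊥-elim (v≢x (permutation-injective π (trans πv (sym πx))))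
  ... | suc zero    = ⊥-elim (v≢y (permutation-injective π (trans πv (sym πy))))
  ... | suc (suc k) = k , refl

  preserves : ∀ {u v} → Role x y u → Role x y v → bookAdjWith (adj G x y) (π ⟨$⟩ʳ u) (π ⟨$⟩ʳ v) ≡ adj G u v
  preserves spine-x spine-x rewrite πx = sym (loopless G x)
  preserves spine-x spine-y rewrite πx | πy = refl
  preserves spine-y spine-x rewrite πx | πy = Graph.sym G x y
  preserves spine-y spine-y rewrite πy = sym (loopless G y)
  preserves spine-x (page v≢x v≢y) with page-image v≢x v≢y
  ... | _ , πv rewrite πx | πv = sym (edge-sym G (proj₁ (attached _ v≢x v≢y)))
  preserves spine-y (page v≢x v≢y) with page-image v≢x v≢y
  ... | _ , πv rewrite πy | πv = sym (edge-sym G (proj₂ (attached _ v≢x v≢y)))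
  preserves (page u≢x u≢y) spine-x with page-image u≢x u≢y
  ... | _ , πu rewrite πx | πu = sym (proj₁ (attached _ u≢x u≢y))
  preserves (page u≢x u≢y) spine-y with page-image u≢x u≢y
  ... | _ , πu rewrite πy | πu = sym (proj₂ (attached _ u≢x u≢y))
  preserves (page u≢x u≢y) (page v≢x v≢y) with page-image u≢x u≢y | page-image v≢x v≢y
  ... | _ , πu | _ , πv rewrite πu | πv = sym (cover-nonadjacent G cover u≢x u≢y v≢x v≢y)

true-or-false : ∀ {P : Bool → Set} b → P b → P true ⊎ P false
true-or-false true  p = inj₁ p
true-or-false false p = inj₂ p

book-structure : ∀ {m} (G : Graph (suc (suc m))) → 7 ≤ suc (suc m) → ¬ HasMatching3 G → MinDegree≥ G 2 →
                 G ≅Book[ true ] ⊎ G ≅Book[ false ]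
book-structure G 7≤n no-3-matching δ≥2 =
  let neighbours = two-neighbours G δ≥2
      (x , y , x≢y , cover) = MatchingFree.two-vertex-cover G no-3-matching neighbours 7≤n
  in true-or-false {_≅Book[_] G} (adj G x y) (book-from-cover G x≢y cover (cover-attached G neighbours cover))

theorem6 : (t : ℕ) → (G : Graph (t + 2)) → 7 ≤ t + 2 →
    ¬ HasMatching3 G → MinDegree≥ G 2 →
    (G ≅ Book t) ⊎ (G ≅ Book⁻ t)
theorem6 t = subst BookStructure (+-comm 2 t) book-structure
  where
  -- t + 2 is not a successor by computation, so transport from 2 + t.
  BookStructure : ℕ → Set
  BookStructure n = (G : Graph n) → 7 ≤ n → ¬ HasMatching3 G → MinDegree≥ G 2 →
                    G ≅Book[ true ] ⊎ G ≅Book[ false ]
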